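{- Let $\pi\in I(321)_{2m}$ be an involution without fixed points, written as a product of $m$ transpositions $\pi=(m_1,M_1)(m_2,M_2)\cdots(m_m,M_m)$ with $m_i<M_i$ for all $i$, $1=m_1<m_2<\cdots<m_m$ and $M_1<M_2<\cdots<M_m$. Define $\pi'$ as the involution of $\{1,\dots,2m\}$ with fixed points $1$ and $M_m$ and transpositions $(m_2,M_1),(m_3,M_2),\dots,(m_m,M_{m-1})$, i.e. $$\pi'=(1)(m_2,M_1)(m_3,M_2)\cdots(m_m,M_{m-1})(M_m).$$ Then $\pi'\in I(321)_{2m}$.
   Context: A permutation of length $n$ is a bijection of $\{1,\dots,n\}$. A permutation avoids $321$ if it has no indices $i<j<k$ with $\pi(i)>\pi(j)>\pi(k)$. An involution satisfies $\pi(\pi(i))=i$ for all $i$. $I(321)_n$ is the set of involutions of length $n$ avoiding $321$. -}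

module Defs where

open import Data.Nat using (ℕ)
open import Data.Fin using (Fin; _<_)
open import Data.Product using (Σ; _×_; ∃; ∃-syntax)
open import Relation.Binary.PropositionalEquality using (_≡_)
open import Relation.Nullary using (¬_)

-- A map {1..n} → {1..n}, with {1..n} represented 0-indexed as Fin n.
-- Positions/values are compared by the usual order on Fin n.

-- Involution: π (π i) = i for all i (this makes π a bijection, hence a permutation).
IsInvolution : {n : ℕ} → (Fin n → Fin n) → Set
IsInvolution π = ∀ i → π (π i) ≡ i

Avoids321 : {n : ℕ} → (Fin n → Fin n) → Set
Avoids321 π = ¬ (∃[ i ] ∃[ j ] ∃[ k ]
  (i < j × j < k × π j < π i × π k < π j))

InI321 : {n : ℕ} → (Fin n → Fin n) → Set
InI321 π = IsInvolution π × Avoids321 π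

FixedPointFree : {n : ℕ} → (Fin n → Fin n) → Set
FixedPointFree π = ∀ i → ¬ (π i ≡ i)

module Submission where

-- Call the points m₁ < … < m_m the *openers* and M₁ < … < M_m
-- the *closers* of the matching π.  The new involution π' sends the
-- openers, in increasing order, to m₁, M₁, …, M_{m-1}, and the closers, in
-- increasing order, to m₂, …, m_m, M_m; both image sequences are
-- increasing.  So π' is the union of two increasing subsequences, and such
-- a map avoids 321: among three positions two are of the same kind, and π'
-- cannot reverse them.  That π' is an involution is checked pointwise,
-- since every point is an opener or a closer.

open import Defs
open import Data.Nat using (ℕ; suc; _*_)
open import Data.Fin using (Fin; zero; suc; _<_; _≤_; inject₁; fromℕ)
open import Data.Fin.Properties using (<-cmp; <-asym; <-trans; toℕ-inject₁; ≤fromℕ)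
open import Data.Fin.Relation.Unary.Top using (view; ‵fromℕ; ‵inject₁)
open import Data.Product using (∃-syntax; _,_)
open import Data.Sum using (_⊎_; inj₁; inj₂)
open import Data.Empty using (⊥; ⊥-elim)
open import Relation.Binary.Definitions using (tri<; tri≈; tri>)
open import Relation.Binary.PropositionalEquality using (_≡_; refl; sym; trans; cong; subst₂)
import Data.Nat as ℕ
import Data.Nat.Properties as ℕ

Increasing : {a b : ℕ} → (Fin a → Fin b) → Set
Increasing f = ∀ i j → i < j → f i < f j

increasing-cancel-< : {a b : ℕ} {f : Fin a → Fin b} → Increasing f →
                      ∀ {i j} → f i < f j → i < j
increasing-cancel-< inc {i} {j} fi<fj with <-cmp i j
... | tri< i<j _ _ = i<j
... | tri≈ _ refl _ = ⊥-elim (ℕ.<-irrefl refl fi<fj)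
... | tri> _ _ j<i = ⊥-elim (<-asym fi<fj (inc j i j<i))

increasing-mono-≤ : {a b : ℕ} {f : Fin a → Fin b} → Increasing f →
                    ∀ {i j} → i ≤ j → f i ≤ f j
increasing-mono-≤ inc {i} {j} i≤j with <-cmp i j
... | tri< i<j _ _ = ℕ.<⇒≤ (inc i j i<j)
... | tri≈ _ refl _ = ℕ.≤-refl
... | tri> _ _ j<i = ⊥-elim (ℕ.<⇒≱ j<i i≤j)

inject₁-mono-< : {k : ℕ} {i j : Fin k} → i < j → inject₁ i < inject₁ j
inject₁-mono-< {i = i} {j} = subst₂ ℕ._<_ (sym (toℕ-inject₁ i)) (sym (toℕ-inject₁ j))

inject₁-cancel-< : {k : ℕ} {i j : Fin k} → inject₁ i < inject₁ j → i < j
inject₁-cancel-< {i = i} {j} = subst₂ ℕ._<_ (toℕ-inject₁ i) (toℕ-inject₁ j)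

IncreasingOn : {n : ℕ} → (Fin n → Set) → (Fin n → Fin n) → Set
IncreasingOn P f = ∀ {x y} → P x → P y → x < y → f x < f y

-- A map whose domain is covered by two sets on each of which it is
-- increasing avoids 321: of any three positions, two lie in the same set.
two-increasing⇒avoids321 : {n : ℕ} (P Q : Fin n → Set) (f : Fin n → Fin n) →
  (∀ x → P x ⊎ Q x) → IncreasingOn P f → IncreasingOn Q f → Avoids321 f
two-increasing⇒avoids321 P Q f cover incP incQ (i , j , l , i<j , j<l , fj<fi , fl<fj)
  = pigeonhole (cover i) (cover j) (cover l)
  where
  i<l : i < l
  i<l = <-trans i<j j<l
  fl<fi : f l < f i
  fl<fi = <-trans fl<fj fj<fi

  pigeonhole : P i ⊎ Q i → P j ⊎ Q j → P l ⊎ Q l → ⊥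
  pigeonhole (inj₁ p) (inj₁ q) _        = <-asym fj<fi (incP p q i<j)
  pigeonhole (inj₂ p) (inj₂ q) _        = <-asym fj<fi (incQ p q i<j)
  pigeonhole _        (inj₁ p) (inj₁ q) = <-asym fl<fj (incP p q j<l)
  pigeonhole _        (inj₂ p) (inj₂ q) = <-asym fl<fj (incQ p q j<l)
  pigeonhole (inj₁ p) (inj₂ _) (inj₁ q) = <-asym fl<fi (incP p q i<l)
  pigeonhole (inj₂ p) (inj₁ _) (inj₂ q) = <-asym fl<fi (incQ p q i<l)

module ShiftedMatching
  (k : ℕ) (mm MM : Fin (suc k) → Fin (2 * suc k)) (π' : Fin (2 * suc k) → Fin (2 * suc k))
  (opener<closer : ∀ i → mm i < MM i)
  (first-opener : mm zero ≡ zero)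
  (mm-inc : Increasing mm)
  (MM-inc : Increasing MM)
  (fix-first : π' (mm zero) ≡ mm zero)
  (fix-last : π' (MM (fromℕ k)) ≡ MM (fromℕ k))
  (opener↦closer : ∀ (i : Fin k) → π' (mm (suc i)) ≡ MM (inject₁ i))
  (closer↦opener : ∀ (i : Fin k) → π' (MM (inject₁ i)) ≡ mm (suc i))
  where

  Opener Closer : Fin (2 * suc k) → Set
  Opener x = ∃[ i ] x ≡ mm i
  Closer x = ∃[ i ] x ≡ MM i

  opener-images-increasing : Increasing (λ i → π' (mm i))
  opener-images-increasing zero    zero    ()
  opener-images-increasing (suc i) zero    ()
  opener-images-increasing zero    (suc j) _ =
    subst₂ _<_ (sym (trans fix-first first-opener)) (sym (opener↦closer j))
      (ℕ.<-≤-trans (ℕ.s≤s ℕ.z≤n) (opener<closer (inject₁ j)))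
  opener-images-increasing (suc i) (suc j) si<sj =
    subst₂ _<_ (sym (opener↦closer i)) (sym (opener↦closer j))
      (MM-inc _ _ (inject₁-mono-< (ℕ.s<s⁻¹ si<sj)))

  closer-images-increasing : Increasing (λ i → π' (MM i))
  closer-images-increasing a b a<b with view a | view b
  ... | ‵fromℕ     | _          = ⊥-elim (ℕ.≤⇒≯ (≤fromℕ b) a<b)
  ... | ‵inject₁ i | ‵inject₁ j =
    subst₂ _<_ (sym (closer↦opener i)) (sym (closer↦opener j))
      (mm-inc _ _ (ℕ.s<s (inject₁-cancel-< a<b)))
  ... | ‵inject₁ i | ‵fromℕ     =
    subst₂ _<_ (sym (closer↦opener i)) (sym fix-last)
      (ℕ.<-≤-trans (opener<closer (suc i)) (increasing-mono-≤ MM-inc (≤fromℕ (suc i))))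

  increasing-on-openers : IncreasingOn Opener π'
  increasing-on-openers (a , refl) (b , refl) ma<mb =
    opener-images-increasing a b (increasing-cancel-< mm-inc ma<mb)

  increasing-on-closers : IncreasingOn Closer π'
  increasing-on-closers (a , refl) (b , refl) Ma<Mb =
    closer-images-increasing a b (increasing-cancel-< MM-inc Ma<Mb)

  involution : (∀ x → Opener x ⊎ Closer x) → IsInvolution π'
  involution cover x with cover x
  ... | inj₁ (zero , refl)  = trans (cong π' fix-first) fix-first
  ... | inj₁ (suc i , refl) = trans (cong π' (opener↦closer i)) (closer↦opener i)
  ... | inj₂ (a , refl) with view a
  ...   | ‵inject₁ i = trans (cong π' (closer↦opener i)) (opener↦closer i)
  ...   | ‵fromℕ     = trans (cong π' fix-last) fix-last

proposition3p3 : (k : ℕ) (π : Fin (2 * suc k) → Fin (2 * suc k))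
    (mm MM : Fin (suc k) → Fin (2 * suc k)) →
    InI321 π → FixedPointFree π →
    (∀ i → mm i < MM i) →
    mm zero ≡ zero →
    (∀ i j → i < j → mm i < mm j) →
    (∀ i j → i < j → MM i < MM j) →
    (∀ i → π (mm i) ≡ MM i) →
    (∀ x → (∃[ i ] x ≡ mm i) ⊎ (∃[ i ] x ≡ MM i)) →
    (π' : Fin (2 * suc k) → Fin (2 * suc k)) →
    π' (mm zero) ≡ mm zero →
    π' (MM (fromℕ k)) ≡ MM (fromℕ k) →
    (∀ (i : Fin k) → π' (mm (suc i)) ≡ MM (inject₁ i)) →
    (∀ (i : Fin k) → π' (MM (inject₁ i)) ≡ mm (suc i)) →
    InI321 π'
proposition3p3 k _ mm MM _ _ lt m0 mm-inc MM-inc _ cover π' h0 hk h1 h2 =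
    involution cover
  , two-increasing⇒avoids321 Opener Closer π' cover increasing-on-openers increasing-on-closers
  where open ShiftedMatching k mm MM π' lt m0 mm-inc MM-inc h0 hk h1 h2
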